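{- Let $n\ge1$, $B_n=\{0,1\}^n$, and for $\sigma\in S_n$ let $\sigma'$ be the permutation of $B_n$ given by $\sigma'(x_1,\dots,x_n)=(x_{\sigma(1)},\dots,x_{\sigma(n)})$. Let $\sigma=\alpha_1\alpha_2\cdots\alpha_m$ be the decomposition of $\sigma$ into disjoint cycles, with $\alpha_i$ of length $k_i$ (so $k_1+\dots+k_m=n$, fixed points counted as cycles of length $1$). Define integers $e(k)$, $k\ge1$, by $e(1)=2$ and $$e(k)=\frac1k\Big(2^k-\sum_{d\mid k,\ d<k} d\,e(d)\Big),\quad k>1.$$ Then the cycle index monomial $\prod_j f_j^{p'_j}$ of $\sigma'$ is $$\prod_{z_1\mid k_1}\prod_{z_2\mid k_2}\cdots\prod_{z_m\mid k_m} f_{\langle z_1,\dots,z_m\rangle}^{\prod_{i=1}^m z_i e(z_i)/\langle z_1,\dots,z_m\rangle};$$ that is, for every $j\ge1$ the number $p'_j$ of cycles of length $j$ of $\sigma'$ equals $$p'_j=\sum_{\substack{(z_1,\dots,z_m):\ z_i\mid k_i\ \forall i\\ \langle z_1,\dots,z_m\rangle=j}}\frac{\prod_{i=1}^m z_i\,e(z_i)}{j}.$$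
   Context: $\langle z_1,\dots,z_m\rangle$ denotes the least common multiple of $z_1,\dots,z_m$. The cycle index monomial of a permutation with $p'_j$ cycles of length $j$ is $\prod_j f_j^{p'_j}$ in independent variables $f_j$; monomials $f_a^{u}$ and $f_a^{v}$ multiply as usual ($f_a^{u+v}$). -}

module Defs where

open import Data.Bool using (Bool; true; false; _∧_)
open import Data.Nat using (ℕ; zero; suc; _+_; _*_; _∸_; _^_; _≤ᵇ_; _≡ᵇ_; _<ᵇ_; NonZero)
open import Data.Nat.DivMod using (_/_)
open import Data.Nat.Divisibility using (_∣?_)
open import Data.Nat.LCM using (lcm)
open import Data.Nat.ListAction using (sum; product)
open import Data.Bool.ListAction using (and)
open import Data.Fin using (Fin; toℕ)
open import Data.Fin.Properties using (_≟_)
open import Data.Fin.Permutation using (Permutation′; _⟨$⟩ʳ_)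
open import Data.List using (List; []; _∷_; map; filter; filterᵇ; length; foldr; concatMap; upTo; allFin)
open import Data.Vec using (Vec; tabulate; lookup)
import Data.Vec as V
open import Data.Vec.Properties using (≡-dec)
import Data.Bool.Properties as BP
open import Relation.Nullary using (yes; no)
open import Relation.Binary.Definitions using (DecidableEquality)

-- Generic cycle structure of a self-map g of a finite type A, given an
-- exhaustive duplicate-free enumeration, decidable equality, an injective
-- "rank" into ℕ (used only to pick a canonical representative of each
-- cycle) and a bound N ≥ |A|.

iter : {A : Set} → (A → A) → ℕ → A → A
iter g zero    x = x
iter g (suc i) x = g (iter g i x)

-- least t with start ≤ t, t < start + fuel and g^t x = x  (0 if none)
searchPeriod : {A : Set} → DecidableEquality A → (A → A) → A → ℕ → ℕ → ℕ
searchPeriod eq g x t zero = 0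
searchPeriod eq g x t (suc fuel) with eq (iter g t x) x
... | yes _ = t
... | no  _ = searchPeriod eq g x (suc t) fuel

-- length of the cycle of g through x: least t ≥ 1 with g^t x = x
-- (N is a bound on the size of A, so the search is exhaustive)
cycleLen : {A : Set} → DecidableEquality A → ℕ → (A → A) → A → ℕ
cycleLen eq N g x = searchPeriod eq g x 1 N

isLeader : {A : Set} → DecidableEquality A → ℕ → (A → ℕ) → (A → A) → A → Bool
isLeader eq N rank g x = and (map (λ i → rank x ≤ᵇ rank (iter g i x)) (upTo (cycleLen eq N g x)))

cycleLengths : {A : Set} → List A → DecidableEquality A → ℕ → (A → ℕ) → (A → A) → List ℕ
cycleLengths enum eq N rank g = map (cycleLen eq N g) (filterᵇ (isLeader eq N rank g) enum)

numCycles : {A : Set} → List A → DecidableEquality A → ℕ → (A → ℕ) → (A → A) → ℕ → ℕ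
numCycles enum eq N rank g j = length (filterᵇ (λ k → k ≡ᵇ j) (cycleLengths enum eq N rank g))

cycleType : {n : ℕ} → Permutation′ n → List ℕ
cycleType {n} σ = cycleLengths (allFin n) _≟_ n toℕ (σ ⟨$⟩ʳ_)

B : ℕ → Set
B n = Vec Bool n

allB : (n : ℕ) → List (B n)
allB zero    = V.[] ∷ []
allB (suc n) = map (true V.∷_) (allB n) Data.List.++ map (false V.∷_) (allB n)

rankB : {n : ℕ} → B n → ℕ
rankB V.[]          = 0
rankB (false V.∷ x) = 2 * rankB x
rankB (true  V.∷ x) = 1 + 2 * rankB x

eqB : {n : ℕ} → DecidableEquality (B n)
eqB = ≡-dec BP._≟_

lift : {n : ℕ} → Permutation′ n → B n → B n
lift σ x = tabulate (λ i → lookup x (σ ⟨$⟩ʳ i))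

p′ : {n : ℕ} → Permutation′ n → ℕ → ℕ
p′ {n} σ = numCycles (allB n) eqB (2 ^ n) rankB (lift σ)

-- e(1) = 2,  e(k) = (2^k − Σ_{d∣k, d<k} d e(d)) / k  for k > 1.
-- (natural-number subtraction/division; the paper asserts exactness)

properDivisors : ℕ → List ℕ
properDivisors k = filter (_∣? k) (filterᵇ (λ d → 1 ≤ᵇ d) (upTo k))

eAux : ℕ → ℕ → ℕ
eAux zero       k = 0
eAux (suc fuel) 0 = 0
eAux (suc fuel) 1 = 2
eAux (suc fuel) k@(suc (suc k′)) =
  (2 ^ k ∸ sum (map (λ d → d * eAux fuel d) (properDivisors k))) / k

e : ℕ → ℕ
e k = eAux k k

divisors : ℕ → List ℕ
divisors k = filter (_∣? k) (filterᵇ (λ d → 1 ≤ᵇ d) (upTo (suc k)))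

divTuples : List ℕ → List (List ℕ)
divTuples []       = [] ∷ []
divTuples (k ∷ ks) = concatMap (λ z → map (z ∷_) (divTuples ks)) (divisors k)

lcmList : List ℕ → ℕ
lcmList = foldr lcm 1

formula : List ℕ → (j : ℕ) → .{{NonZero j}} → ℕ
formula ks j = sum (map (λ zs → product (map (λ z → z * e z) zs) / j)
                        (filterᵇ (λ zs → lcmList zs ≡ᵇ j) (divTuples ks)))

-- Reading a word x along each cycle of σ, starting from a
-- fixed representative, identifies Bₙ with the product of the B_{kᵢ}, and under this identification
-- σ′ rotates every component by one place; so the σ′-period of x is the lcm of the rotation periods
-- of its components. The rotation period of a word of length k divides k, and for d ∣ k the words
-- whose period divides d are the 2ᵈ repetitions of words of length d; hence Σ_{z ∣ d} #(period z) = 2ᵈ,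
-- which is the recursion defining e, and exactly z e(z) words have period z. Summing over the tuples
-- of component periods, Σ_{⟨z⟩ = j} Π zᵢ e(zᵢ) words have σ′-period j, and a cycle of length j
-- contains j of them.

module Submission where

open import Defs

open import Data.Bool using (Bool; true; false; T)
open import Data.Bool.ListAction using (and)
open import Data.Empty using (⊥; ⊥-elim)
open import Data.Fin using (Fin; toℕ; fromℕ<)
open import Data.Fin.Permutation using (Permutation′; _⟨$⟩ʳ_; _⟨$⟩ˡ_; inverseˡ; inverseʳ)
import Data.Fin.Properties as Fin
import Data.List
open import Data.List using (List; []; _∷_; [_]; _++_; map; filter; filterᵇ; length; concatMap; applyUpTo; upTo; allFin)
import Data.List.Properties as List
import Data.List.Membership.DecPropositional as DecMembership
open import Data.List.Membership.Propositional using (_∈_)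
open import Data.List.Membership.Propositional.Properties
open import Data.List.Membership.Propositional.Properties.WithK using (unique∧set⇒bag)
open import Data.List.Relation.Binary.BagAndSetEquality using (∼bag⇒↭)
open import Data.List.Relation.Binary.Disjoint.Propositional using (Disjoint)
open import Data.List.Relation.Binary.Permutation.Propositional using (_↭_)
import Data.List.Relation.Binary.Permutation.Propositional.Properties as ↭
open import Data.List.Relation.Unary.All as All using (All; []; _∷_)
import Data.List.Relation.Unary.All.Properties as AllP
import Data.List.Relation.Unary.AllPairs as AllPairs
import Data.List.Relation.Unary.AllPairs.Properties as AllPairsP
open import Data.List.Relation.Unary.Any as Any using (here; there; index)
import Data.List.Relation.Unary.Any.Properties as AnyP
open import Data.List.Relation.Unary.Unique.Propositional using (Unique)
import Data.List.Relation.Unary.Unique.Propositional.Properties as Unique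
open import Data.Nat
open import Data.Nat.DivMod
open import Data.Nat.Divisibility
open import Data.Nat.Induction using (<-rec)
open import Data.Nat.LCM using (lcm-least; m∣lcm[m,n]; n∣lcm[m,n])
open import Data.Nat.ListAction using (sum; product)
open import Data.Nat.ListAction.Properties using (sum-↭)
open import Data.Nat.Properties
open import Algebra.Properties.CommutativeSemigroup +-commutativeSemigroup using () renaming (interchange to +-interchange)
open import Algebra.Properties.CommutativeSemigroup *-commutativeSemigroup using () renaming (x∙yz≈y∙xz to m*[n*o]≡n*[m*o])
open import Data.Product using (∃; _×_; _,_; proj₁; proj₂)
import Data.Product.Properties as ×
open import Data.Sum using (inj₁; inj₂)
open import Data.Unit using (⊤; tt)
import Data.Vec as V
open import Data.Vec using (tabulate; lookup)
import Data.Vec.Properties as V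
open import Function.Base using (id; _∘_)
open import Function.Bundles using (_⇔_; mk⇔; module Equivalence)
open import Relation.Binary.Definitions using (DecidableEquality; tri<; tri≈; tri>)
open import Relation.Binary.PropositionalEquality hiding ([_])
open import Relation.Nullary using (¬_; Dec; yes; no; does)
open import Relation.Nullary.Decidable using (T?; dec-true; dec-false)

χ : Bool → ℕ
χ true  = 1
χ false = 0

∑ : {A : Set} → List A → (A → ℕ) → ℕ
∑ xs f = sum (map f xs)

count : {A : Set} → (A → Bool) → List A → ℕ
count p xs = ∑ xs (λ x → χ (p x))

∑-cong : {A : Set} (xs : List A) {f g : A → ℕ} → (∀ x → x ∈ xs → f x ≡ g x) → ∑ xs f ≡ ∑ xs g
∑-cong []       h = refl
∑-cong (x ∷ xs) h = cong₂ _+_ (h x (here refl)) (∑-cong xs (λ y m → h y (there m)))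

∑-++ : {A : Set} (xs ys : List A) (f : A → ℕ) → ∑ (xs ++ ys) f ≡ ∑ xs f + ∑ ys f
∑-++ []       ys f = refl
∑-++ (x ∷ xs) ys f = trans (cong (f x +_) (∑-++ xs ys f)) (sym (+-assoc (f x) _ _))

∑-map : {A B : Set} (xs : List A) (g : A → B) (f : B → ℕ) → ∑ (map g xs) f ≡ ∑ xs (λ x → f (g x))
∑-map []       g f = refl
∑-map (x ∷ xs) g f = cong (f (g x) +_) (∑-map xs g f)

∑-concatMap : {A B : Set} (xs : List A) (g : A → List B) (f : B → ℕ) →
              ∑ (concatMap g xs) f ≡ ∑ xs (λ x → ∑ (g x) f)
∑-concatMap []       g f = refl
∑-concatMap (x ∷ xs) g f = trans (∑-++ (g x) (concatMap g xs) f) (cong (∑ (g x) f +_) (∑-concatMap xs g f))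

length-concatMap : {A B : Set} (f : A → List B) (xs : List A) → length (concatMap f xs) ≡ ∑ xs (λ x → length (f x))
length-concatMap f []       = refl
length-concatMap f (x ∷ xs) = trans (List.length-++ (f x)) (cong (length (f x) +_) (length-concatMap f xs))

∑-↭ : {A : Set} {xs ys : List A} (f : A → ℕ) → xs ↭ ys → ∑ xs f ≡ ∑ ys f
∑-↭ f p = sum-↭ (↭.map⁺ f p)

∑-const : {A : Set} (xs : List A) (c : ℕ) → ∑ xs (λ _ → c) ≡ length xs * c
∑-const []       c = refl
∑-const (x ∷ xs) c = cong (c +_) (∑-const xs c)

∑-+ : {A : Set} (xs : List A) (f g : A → ℕ) → ∑ xs (λ x → f x + g x) ≡ ∑ xs f + ∑ xs g
∑-+ []       f g = refl
∑-+ (x ∷ xs) f g = trans (cong (f x + g x +_) (∑-+ xs f g)) (+-interchange (f x) (g x) (∑ xs f) (∑ xs g))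

∑-swap : {A B : Set} (xs : List A) (ys : List B) (f : A → B → ℕ) →
         ∑ xs (λ x → ∑ ys (f x)) ≡ ∑ ys (λ y → ∑ xs (λ x → f x y))
∑-swap []       ys f = sym (trans (∑-const ys 0) (*-zeroʳ (length ys)))
∑-swap (x ∷ xs) ys f = trans (cong (∑ ys (f x) +_) (∑-swap xs ys f))
                             (sym (∑-+ ys (f x) (λ y → ∑ xs (λ x′ → f x′ y))))

∑-*ʳ : {A : Set} (xs : List A) (f : A → ℕ) (c : ℕ) → ∑ xs f * c ≡ ∑ xs (λ x → f x * c)
∑-*ʳ []       f c = refl
∑-*ʳ (x ∷ xs) f c = trans (*-distribʳ-+ c (f x) (∑ xs f)) (cong (f x * c +_) (∑-*ʳ xs f c))

∑-filterᵇ : {A : Set} (p : A → Bool) (xs : List A) (f : A → ℕ) →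
            ∑ (filterᵇ p xs) f ≡ ∑ xs (λ x → χ (p x) * f x)
∑-filterᵇ p []       f = refl
∑-filterᵇ p (x ∷ xs) f with p x
... | true  = cong₂ _+_ (sym (+-identityʳ (f x))) (∑-filterᵇ p xs f)
... | false = ∑-filterᵇ p xs f

∑-χ*-const : {A : Set} (xs : List A) (p : A → Bool) (f : A → ℕ) (c : ℕ) →
             (∀ x → p x ≡ true → f x ≡ c) → ∑ xs (λ x → χ (p x) * f x) ≡ count p xs * c
∑-χ*-const []       p f c h = refl
∑-χ*-const (x ∷ xs) p f c h with p x in px
... | true  = cong₂ _+_ (trans (+-identityʳ (f x)) (h x px)) (∑-χ*-const xs p f c h)
... | false = ∑-χ*-const xs p f c h

length-filterᵇ : {A : Set} (p : A → Bool) (xs : List A) → length (filterᵇ p xs) ≡ count p xs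
length-filterᵇ p []       = refl
length-filterᵇ p (x ∷ xs) with p x
... | true  = cong suc (length-filterᵇ p xs)
... | false = length-filterᵇ p xs

T⇒≡true : ∀ {b} → T b → b ≡ true
T⇒≡true {true} _ = refl

≡true⇒T : ∀ {b} → b ≡ true → T b
≡true⇒T refl = _

dec-true⁻¹ : {P : Set} (P? : Dec P) → does P? ≡ true → P
dec-true⁻¹ (yes p) _ = p

∈-filterᵇ⁺ : {A : Set} {p : A → Bool} {x : A} {xs : List A} → x ∈ xs → p x ≡ true → x ∈ filterᵇ p xs
∈-filterᵇ⁺ {p = p} x∈ px = ∈-filter⁺ (λ y → T? (p y)) x∈ (≡true⇒T px)

∈-filterᵇ⁻ : {A : Set} (p : A → Bool) (xs : List A) {x : A} → x ∈ filterᵇ p xs → x ∈ xs × p x ≡ true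
∈-filterᵇ⁻ p xs x∈ with ∈-filter⁻ (λ y → T? (p y)) x∈
... | x∈xs , px = x∈xs , T⇒≡true px

unique-filterᵇ : {A : Set} (p : A → Bool) {xs : List A} → Unique xs → Unique (filterᵇ p xs)
unique-filterᵇ p = Unique.filter⁺ (λ y → T? (p y))

unique-applyUpTo : {A : Set} (f : ℕ → A) (n : ℕ) →
                   (∀ a b → a < n → b < n → f a ≡ f b → a ≡ b) → Unique (applyUpTo f n)
unique-applyUpTo f zero    inj = AllPairs.[]
unique-applyUpTo f (suc n) inj =
  All.tabulate (λ v∈ f0≡v → f0∉ (∈-applyUpTo⁻ (λ i → f (suc i)) v∈) f0≡v)
  AllPairs.∷ unique-applyUpTo (λ i → f (suc i)) n
               (λ a b a<n b<n e → suc-injective (inj (suc a) (suc b) (s≤s a<n) (s≤s b<n) e))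
  where
  f0∉ : ∀ {v} → (∃ λ i → i < n × v ≡ f (suc i)) → f 0 ≢ v
  f0∉ (i , i<n , refl) e with () ← inj 0 (suc i) z<s (s≤s i<n) e

unique-sameMembers⇒↭ : {A : Set} {xs ys : List A} → Unique xs → Unique ys →
                       (∀ {z} → z ∈ xs → z ∈ ys) → (∀ {z} → z ∈ ys → z ∈ xs) → xs ↭ ys
unique-sameMembers⇒↭ ux uy f g = ∼bag⇒↭ (unique∧set⇒bag ux uy (mk⇔ f g))

unique-sameMembers⇒length≡ : {A : Set} {xs ys : List A} → Unique xs → Unique ys →
                             (∀ {z} → z ∈ xs → z ∈ ys) → (∀ {z} → z ∈ ys → z ∈ xs) → length xs ≡ length ys
unique-sameMembers⇒length≡ ux uy f g = ↭.↭-length (unique-sameMembers⇒↭ ux uy f g)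

unique-⊆⇒length≤ : {A : Set} {xs ys : List A} → Unique xs → (∀ {z} → z ∈ xs → z ∈ ys) → length xs ≤ length ys
unique-⊆⇒length≤ {xs = []}     _                      _   = z≤n
unique-⊆⇒length≤ {xs = x ∷ xs} (x∉xs AllPairs.∷ uxs) xs⊆ with ∈-∃++ (xs⊆ (here refl))
... | as , bs , refl = begin
  suc (length xs)             ≤⟨ s≤s (unique-⊆⇒length≤ uxs xs⊆as++bs) ⟩
  suc (length (as ++ bs))     ≡⟨ cong suc (List.length-++ as) ⟩
  suc (length as + length bs) ≡⟨ +-suc (length as) (length bs) ⟨
  length as + suc (length bs) ≡⟨ List.length-++ as ⟨
  length (as ++ x ∷ bs)       ∎
  where
  open ≤-Reasoning
  xs⊆as++bs : ∀ {z} → z ∈ xs → z ∈ as ++ bs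
  xs⊆as++bs z∈ with ∈-++⁻ as (xs⊆ (there z∈))
  ... | inj₁ p         = ∈-++⁺ˡ p
  ... | inj₂ (here refl) = ⊥-elim (All.lookup x∉xs z∈ refl)
  ... | inj₂ (there p) = ∈-++⁺ʳ as p

unique-⊆-length≥⇒⊇ : {A : Set} → DecidableEquality A → {xs ys : List A} → Unique xs →
                     (∀ {z} → z ∈ xs → z ∈ ys) → length ys ≤ length xs → ∀ {z} → z ∈ ys → z ∈ xs
unique-⊆-length≥⇒⊇ _≟_ {xs} {ys} u xs⊆ys ys≤xs {z} z∈ys with DecMembership._∈?_ _≟_ z xs
... | yes z∈xs = z∈xs
... | no  z∉xs = ⊥-elim (<-irrefl refl (≤-trans (unique-⊆⇒length≤ u′ z∷xs⊆ys) ys≤xs))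
  where
  u′ : Unique (z ∷ xs)
  u′ = All.tabulate (λ y∈ z≡y → z∉xs (subst (_∈ xs) (sym z≡y) y∈)) AllPairs.∷ u
  z∷xs⊆ys : ∀ {y} → y ∈ z ∷ xs → y ∈ ys
  z∷xs⊆ys (here refl) = z∈ys
  z∷xs⊆ys (there y∈)  = xs⊆ys y∈

∃-minimumBy : {A : Set} (rank : A → ℕ) (x : A) (xs : List A) →
              ∃ λ m → m ∈ x ∷ xs × (∀ {y} → y ∈ x ∷ xs → rank m ≤ rank y)
∃-minimumBy rank x [] = x , here refl , λ { (here refl) → ≤-refl }
∃-minimumBy rank x (y ∷ xs) with ∃-minimumBy rank y xs
... | m , m∈ , m≤ with rank x ≤? rank m
... | yes x≤m = x , here refl , λ { (here refl) → ≤-refl ; (there p) → ≤-trans x≤m (m≤ p) }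
... | no  x≰m = m , there m∈ , λ { (here refl) → <⇒≤ (≰⇒> x≰m) ; (there p) → m≤ p }

and-map⁻ : {A : Set} (f : A → Bool) (xs : List A) → and (map f xs) ≡ true → ∀ {x} → x ∈ xs → f x ≡ true
and-map⁻ f (y ∷ xs) e (here refl) with f y
... | true = refl
and-map⁻ f (y ∷ xs) e (there m) with f y
... | true = and-map⁻ f xs e m

and-map⁺ : {A : Set} (f : A → Bool) (xs : List A) → (∀ {x} → x ∈ xs → f x ≡ true) → and (map f xs) ≡ true
and-map⁺ f []       h = refl
and-map⁺ f (y ∷ xs) h rewrite h (here refl) = and-map⁺ f xs (λ m → h (there m))

-- Cycles of an invertible self-map of a finite type

module CycleStructure {A : Set} (enum : List A) (complete : ∀ x → x ∈ enum) (unique : Unique enum)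
         (_≟_ : DecidableEquality A) (N : ℕ) (size≤N : length enum ≤ N)
         (rank : A → ℕ) (rank-injective : ∀ {x y} → rank x ≡ rank y → x ≡ y)
         (g g⁻¹ : A → A) (g⁻¹∘g : ∀ x → g⁻¹ (g x) ≡ x) where

  g^ : ℕ → A → A
  g^ = iter g

  g^-+ : ∀ a b x → g^ (a + b) x ≡ g^ a (g^ b x)
  g^-+ zero    b x = refl
  g^-+ (suc a) b x = cong g (g^-+ a b x)

  g^-comm : ∀ a b x → g^ a (g^ b x) ≡ g^ b (g^ a x)
  g^-comm a b x = trans (sym (g^-+ a b x)) (trans (cong (λ u → g^ u x) (+-comm a b)) (g^-+ b a x))

  g-injective : ∀ {x y} → g x ≡ g y → x ≡ y
  g-injective {x} {y} e = trans (sym (g⁻¹∘g x)) (trans (cong g⁻¹ e) (g⁻¹∘g y))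

  g^-injective : ∀ a {x y} → g^ a x ≡ g^ a y → x ≡ y
  g^-injective zero    e = e
  g^-injective (suc a) e = g^-injective a (g-injective e)

  g^-∸ : ∀ {a b} x → a ≤ b → g^ a (g^ (b ∸ a) x) ≡ g^ b x
  g^-∸ {a} {b} x a≤b = trans (sym (g^-+ a (b ∸ a) x)) (cong (λ u → g^ u x) (m+[n∸m]≡n a≤b))

  -- Pigeonhole on x, g x, …, g^size x.
  ∃-return : ∀ x → ∃ λ t → 1 ≤ t × t ≤ length enum × g^ t x ≡ x
  ∃-return x with Fin.pigeonhole (n<1+n (length enum)) (λ i → index (complete (g^ (toℕ i) x)))
  ... | i , j , i<j , same = toℕ j ∸ toℕ i , m<n⇒0<n∸m i<j , t≤size ,
        g^-injective (toℕ i) (trans (g^-∸ x (<⇒≤ i<j)) (sym (index-injective same)))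
    where
    t≤size : toℕ j ∸ toℕ i ≤ length enum
    t≤size = ≤-trans (m∸n≤m (toℕ j) (toℕ i)) (≤-pred (Fin.toℕ<n j))
    index-injective : ∀ {y z} → index (complete y) ≡ index (complete z) → y ≡ z
    index-injective {y} {z} e = trans (AnyP.lookup-index (complete y))
      (trans (cong (Data.List.lookup enum) e) (sym (AnyP.lookup-index (complete z))))

  record LeastReturn (x : A) (s r : ℕ) : Set where
    field
      start≤ : s ≤ r
      returns : g^ r x ≡ x
      least : ∀ u → s ≤ u → u < r → g^ u x ≢ x

  open LeastReturn

  searchPeriod-least : ∀ fuel s x t → s ≤ t → t < s + fuel → g^ t x ≡ x →
                       LeastReturn x s (searchPeriod _≟_ g x s fuel)
  searchPeriod-least zero s x t s≤t t<s+0 _ =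
    ⊥-elim (<-irrefl refl (≤-trans (subst (t <_) (+-identityʳ s) t<s+0) s≤t))
  searchPeriod-least (suc fuel) s x t s≤t t< gᵗx≡x with g^ s x ≟ x
  ... | yes gˢx≡x = record { start≤ = ≤-refl ; returns = gˢx≡x
                           ; least = λ u s≤u u<s → ⊥-elim (<-irrefl refl (≤-trans u<s s≤u)) }
  ... | no  gˢx≢x = record { start≤ = ≤-trans (n≤1+n s) (start≤ later) ; returns = returns later ; least = least′ }
    where
    s<t : s < t
    s<t = ≤∧≢⇒< s≤t (λ s≡t → gˢx≢x (subst (λ u → g^ u x ≡ x) (sym s≡t) gᵗx≡x))
    later : LeastReturn x (suc s) (searchPeriod _≟_ g x (suc s) fuel)
    later = searchPeriod-least fuel (suc s) x t s<t (subst (t <_) (+-suc s fuel) t<) gᵗx≡x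
    least′ : ∀ u → s ≤ u → u < searchPeriod _≟_ g x (suc s) fuel → g^ u x ≢ x
    least′ u s≤u u<r with s Data.Nat.≟ u
    ... | yes refl = gˢx≢x
    ... | no  s≢u  = least later u (≤∧≢⇒< s≤u s≢u) u<r

  period : A → ℕ
  period = cycleLen _≟_ N g

  period-least : ∀ x → LeastReturn x 1 (period x)
  period-least x with ∃-return x
  ... | t , 1≤t , t≤size , gᵗx≡x = searchPeriod-least N 1 x t 1≤t (s≤s (≤-trans t≤size size≤N)) gᵗx≡x

  period-pos : ∀ x → 1 ≤ period x
  period-pos x = start≤ (period-least x)

  instance
    period-nonZero : ∀ {x} → NonZero (period x)
    period-nonZero {x} = >-nonZero (period-pos x)

  g^period : ∀ x → g^ (period x) x ≡ x
  g^period x = returns (period-least x)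

  g^-*period : ∀ x q → g^ (q * period x) x ≡ x
  g^-*period x zero    = refl
  g^-*period x (suc q) = trans (g^-+ (period x) (q * period x) x)
                               (trans (cong (g^ (period x)) (g^-*period x q)) (g^period x))

  g^-%period : ∀ x t → g^ t x ≡ g^ (t % period x) x
  g^-%period x t = begin
    g^ t x                                             ≡⟨ cong (λ u → g^ u x) (m≡m%n+[m/n]*n t (period x)) ⟩
    g^ (t % period x + t / period x * period x) x      ≡⟨ g^-+ (t % period x) _ x ⟩
    g^ (t % period x) (g^ (t / period x * period x) x) ≡⟨ cong (g^ (t % period x)) (g^-*period x (t / period x)) ⟩
    g^ (t % period x) x                                ∎
    where open ≡-Reasoning

  returns⇒period∣ : ∀ x t → g^ t x ≡ x → period x ∣ t
  returns⇒period∣ x t gᵗx≡x with t % period x in r≡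
  ... | zero  = m%n≡0⇒n∣m t (period x) r≡
  ... | suc r = ⊥-elim (least (period-least x) (suc r) (s≤s z≤n) (subst (_< period x) r≡ (m%n<n t (period x)))
                        (trans (sym (subst (λ u → g^ t x ≡ g^ u x) r≡ (g^-%period x t))) gᵗx≡x))

  period∣⇒returns : ∀ x t → period x ∣ t → g^ t x ≡ x
  period∣⇒returns x .(q * period x) (divides q refl) = g^-*period x q

  period-unique : ∀ x d → (∀ t → g^ t x ≡ x → d ∣ t) → (∀ t → d ∣ t → g^ t x ≡ x) → period x ≡ d
  period-unique x d returns⇒d∣ d∣⇒returns =
    ∣-antisym (returns⇒period∣ x d (d∣⇒returns d ∣-refl)) (returns⇒d∣ (period x) (g^period x))

  period-g^ : ∀ r x → period (g^ r x) ≡ period x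
  period-g^ r x = period-unique (g^ r x) (period x)
    (λ t e → returns⇒period∣ x t (g^-injective r (trans (g^-comm r t x) e)))
    (λ t d → trans (g^-comm t r x) (cong (g^ r) (period∣⇒returns x t d)))

  Orbit : A → A → Set
  Orbit x y = ∃ λ r → g^ r x ≡ y

  orbit-refl : ∀ x → Orbit x x
  orbit-refl x = 0 , refl

  orbit-trans : ∀ {x y z} → Orbit x y → Orbit y z → Orbit x z
  orbit-trans {x} (r , refl) (s , refl) = s + r , g^-+ s r x

  orbit-sym : ∀ {x y} → Orbit x y → Orbit y x
  orbit-sym {x} (r , refl) = r * period x ∸ r , (begin
    g^ (r * period x ∸ r) (g^ r x) ≡⟨ g^-+ (r * period x ∸ r) r x ⟨
    g^ (r * period x ∸ r + r) x    ≡⟨ cong (λ u → g^ u x) (m∸n+n≡m (m≤m*n r (period x))) ⟩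
    g^ (r * period x) x            ≡⟨ g^-*period x r ⟩
    x                              ∎)
    where open ≡-Reasoning

  orbit-bounded : ∀ {x y} → Orbit x y → ∃ λ r → r < period x × g^ r x ≡ y
  orbit-bounded {x} (r , refl) = r % period x , m%n<n r (period x) , sym (g^-%period x r)

  period-orbit : ∀ {x y} → Orbit x y → period x ≡ period y
  period-orbit {x} (r , refl) = sym (period-g^ r x)

  orbit : A → List A
  orbit x = applyUpTo (λ r → g^ r x) (period x)

  ∈-orbit⁺ : ∀ {x y} → Orbit x y → y ∈ orbit x
  ∈-orbit⁺ {x} o with orbit-bounded o
  ... | r , r< , refl = ∈-applyUpTo⁺ (λ r → g^ r x) r<

  ∈-orbit⁻ : ∀ {x y} → y ∈ orbit x → Orbit x y
  ∈-orbit⁻ {x} y∈ with ∈-applyUpTo⁻ (λ r → g^ r x) y∈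
  ... | r , _ , refl = r , refl

  length-orbit : ∀ x → length (orbit x) ≡ period x
  length-orbit x = List.length-applyUpTo (λ r → g^ r x) (period x)

  orbit-unique : ∀ x → Unique (orbit x)
  orbit-unique x = unique-applyUpTo (λ r → g^ r x) (period x) injective
    where
    below-period : ∀ {a b} → a < b → b < period x → g^ a x ≢ g^ b x
    below-period {a} {b} a<b b<p e = least (period-least x) (b ∸ a) (m<n⇒0<n∸m a<b) (≤-<-trans (m∸n≤m b a) b<p)
      (g^-injective a (trans (g^-∸ x (<⇒≤ a<b)) (sym e)))
    injective : ∀ a b → a < period x → b < period x → g^ a x ≡ g^ b x → a ≡ b
    injective a b a<p b<p e with <-cmp a b
    ... | tri< a<b _ _ = ⊥-elim (below-period a<b b<p e)
    ... | tri≈ _ a≡b _ = a≡b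
    ... | tri> _ _ b<a = ⊥-elim (below-period b<a a<p (sym e))

  open DecMembership _≟_ using (_∈?_)

  inOrbitᵇ : A → A → Bool
  inOrbitᵇ c x = does (x ∈? orbit c)

  inOrbitᵇ⁺ : ∀ {c x} → Orbit c x → inOrbitᵇ c x ≡ true
  inOrbitᵇ⁺ {c} {x} o = dec-true (x ∈? orbit c) (∈-orbit⁺ o)

  inOrbitᵇ⁻ : ∀ {c x} → inOrbitᵇ c x ≡ true → Orbit c x
  inOrbitᵇ⁻ {c} {x} e = ∈-orbit⁻ (dec-true⁻¹ (x ∈? orbit c) e)

  leader? : A → Bool
  leader? = isLeader _≟_ N rank g

  leader⇒rank-minimal : ∀ {c} → leader? c ≡ true → ∀ {y} → Orbit c y → rank c ≤ rank y
  leader⇒rank-minimal {c} e o with orbit-bounded o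
  ... | r , r< , refl = ≤ᵇ⇒≤ (rank c) (rank (g^ r c))
        (≡true⇒T (and-map⁻ (λ i → rank c ≤ᵇ rank (g^ i c)) (upTo (period c)) e (∈-upTo⁺ r<)))

  rank-minimal⇒leader : ∀ {c} → (∀ {y} → Orbit c y → rank c ≤ rank y) → leader? c ≡ true
  rank-minimal⇒leader {c} min = and-map⁺ (λ i → rank c ≤ᵇ rank (g^ i c)) (upTo (period c))
                                         (λ {i} _ → T⇒≡true (≤⇒≤ᵇ (min (i , refl))))

  ∃-leader : ∀ x → ∃ λ c → leader? c ≡ true × Orbit x c
  ∃-leader x with orbit x in orbit≡ | ∈-orbit⁺ (orbit-refl x)
  ... | y ∷ ys | _ with ∃-minimumBy rank y ys
  ... | c , c∈ , c≤ = c , rank-minimal⇒leader (λ o → c≤ (∈orbit (orbit-trans (orbit∈ c∈) o))) , orbit∈ c∈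
    where
    orbit∈ : ∀ {z} → z ∈ y ∷ ys → Orbit x z
    orbit∈ z∈ = ∈-orbit⁻ (subst (_ ∈_) (sym orbit≡) z∈)
    ∈orbit : ∀ {z} → Orbit x z → z ∈ y ∷ ys
    ∈orbit o = subst (_ ∈_) orbit≡ (∈-orbit⁺ o)

  leader-unique : ∀ {c c′} → leader? c ≡ true → leader? c′ ≡ true → Orbit c c′ → c ≡ c′
  leader-unique l l′ o = rank-injective (≤-antisym (leader⇒rank-minimal l o) (leader⇒rank-minimal l′ (orbit-sym o)))

  leaders : List A
  leaders = filterᵇ leader? enum

  leader-covers : ∀ x → ∃ λ c → c ∈ leaders × ∃ λ r → r < period c × g^ r c ≡ x
  leader-covers x with ∃-leader x
  ... | c , l , o = c , ∈-filterᵇ⁺ (complete c) l , orbit-bounded (orbit-sym o)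

  count-leaders-of : ∀ x → count (λ c → inOrbitᵇ c x) leaders ≡ 1
  count-leaders-of x with ∃-leader x
  ... | c , l , o = trans (sym (length-filterᵇ (λ c → inOrbitᵇ c x) leaders))
        (unique-sameMembers⇒length≡ (unique-filterᵇ _ (unique-filterᵇ _ unique)) unique-[c] ⊆[c] [c]⊆)
    where
    unique-[c] : Unique [ c ]
    unique-[c] = [] AllPairs.∷ AllPairs.[]
    ⊆[c] : ∀ {z} → z ∈ filterᵇ (λ c → inOrbitᵇ c x) leaders → z ∈ [ c ]
    ⊆[c] z∈ with ∈-filterᵇ⁻ (λ c → inOrbitᵇ c x) leaders z∈
    ... | z∈leaders , z∼x = here (leader-unique (proj₂ (∈-filterᵇ⁻ leader? enum z∈leaders)) l (orbit-trans (inOrbitᵇ⁻ z∼x) o))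
    [c]⊆ : ∀ {z} → z ∈ [ c ] → z ∈ filterᵇ (λ c → inOrbitᵇ c x) leaders
    [c]⊆ (here refl) = ∈-filterᵇ⁺ (∈-filterᵇ⁺ (complete c) l) (inOrbitᵇ⁺ (orbit-sym o))

  count-orbit : ∀ c → count (inOrbitᵇ c) enum ≡ period c
  count-orbit c = begin
    count (inOrbitᵇ c) enum           ≡⟨ length-filterᵇ (inOrbitᵇ c) enum ⟨
    length (filterᵇ (inOrbitᵇ c) enum) ≡⟨ unique-sameMembers⇒length≡ (unique-filterᵇ (inOrbitᵇ c) unique) (orbit-unique c)
                                           (λ z∈ → ∈-orbit⁺ (inOrbitᵇ⁻ (proj₂ (∈-filterᵇ⁻ (inOrbitᵇ c) enum z∈))))
                                           (λ {z} z∈ → ∈-filterᵇ⁺ (complete z) (inOrbitᵇ⁺ (∈-orbit⁻ z∈))) ⟩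
    length (orbit c)                   ≡⟨ length-orbit c ⟩
    period c                           ∎
    where open ≡-Reasoning

  -- Each x is counted once, through the leader of its cycle, and a cycle with leader c has period c elements.
  ∑-by-cycles : ∀ (f : ℕ → ℕ) → ∑ enum (λ x → f (period x)) ≡ ∑ leaders (λ c → period c * f (period c))
  ∑-by-cycles f = begin
    ∑ enum (λ x → f (period x))
      ≡⟨ ∑-cong enum (λ x _ → via-leader x) ⟩
    ∑ enum (λ x → ∑ leaders (λ c → χ (inOrbitᵇ c x) * f (period c)))
      ≡⟨ ∑-swap enum leaders (λ x c → χ (inOrbitᵇ c x) * f (period c)) ⟩
    ∑ leaders (λ c → ∑ enum (λ x → χ (inOrbitᵇ c x) * f (period c)))
      ≡⟨ ∑-cong leaders (λ c _ → trans (∑-χ*-const enum (inOrbitᵇ c) _ (f (period c)) (λ _ _ → refl))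
                                        (cong (_* f (period c)) (count-orbit c))) ⟩
    ∑ leaders (λ c → period c * f (period c)) ∎
    where
    open ≡-Reasoning
    via-leader : ∀ x → f (period x) ≡ ∑ leaders (λ c → χ (inOrbitᵇ c x) * f (period c))
    via-leader x = sym (begin
      ∑ leaders (λ c → χ (inOrbitᵇ c x) * f (period c)) ≡⟨ ∑-χ*-const leaders (λ c → inOrbitᵇ c x) (λ c → f (period c)) (f (period x))
                                                             (λ c e → cong f (period-orbit (inOrbitᵇ⁻ e))) ⟩
      count (λ c → inOrbitᵇ c x) leaders * f (period x) ≡⟨ cong (_* f (period x)) (count-leaders-of x) ⟩
      1 * f (period x)                                  ≡⟨ *-identityˡ (f (period x)) ⟩
      f (period x)                                      ∎)

  ∑-periods : ∑ leaders period ≡ length enum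
  ∑-periods = begin
    ∑ leaders period                      ≡⟨ ∑-cong leaders (λ c _ → *-identityʳ (period c)) ⟨
    ∑ leaders (λ c → period c * 1)         ≡⟨ ∑-by-cycles (λ _ → 1) ⟨
    ∑ enum (λ _ → 1)                       ≡⟨ ∑-const enum 1 ⟩
    length enum * 1                        ≡⟨ *-identityʳ (length enum) ⟩
    length enum                            ∎
    where open ≡-Reasoning

  numCycles*j : ∀ j → numCycles enum _≟_ N rank g j * j ≡ count (λ x → period x ≡ᵇ j) enum
  numCycles*j j = begin
    numCycles enum _≟_ N rank g j * j
      ≡⟨ cong (_* j) (trans (length-filterᵇ (_≡ᵇ j) (map period leaders)) (∑-map leaders period (λ k → χ (k ≡ᵇ j)))) ⟩
    count (λ c → period c ≡ᵇ j) leaders * j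
      ≡⟨ ∑-χ*-const leaders (λ c → period c ≡ᵇ j) (λ _ → j) j (λ _ _ → refl) ⟨
    ∑ leaders (λ c → χ (period c ≡ᵇ j) * j)
      ≡⟨ ∑-cong leaders (λ c _ → χ*j≡period*χ c) ⟩
    ∑ leaders (λ c → period c * χ (period c ≡ᵇ j))
      ≡⟨ ∑-by-cycles (λ k → χ (k ≡ᵇ j)) ⟨
    count (λ x → period x ≡ᵇ j) enum ∎
    where
    open ≡-Reasoning
    χ*j≡period*χ : ∀ c → χ (period c ≡ᵇ j) * j ≡ period c * χ (period c ≡ᵇ j)
    χ*j≡period*χ c with period c ≡ᵇ j in e
    ... | true  = trans (*-identityˡ j) (trans (sym (≡ᵇ⇒≡ (period c) j (≡true⇒T e))) (sym (*-identityʳ (period c))))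
    ... | false = sym (*-zeroʳ (period c))

allB-complete : ∀ {n} (x : B n) → x ∈ allB n
allB-complete V.[] = here refl
allB-complete {suc n} (true V.∷ x) = ∈-++⁺ˡ (∈-map⁺ (true V.∷_) (allB-complete x))
allB-complete {suc n} (false V.∷ x) = ∈-++⁺ʳ (map (true V.∷_) (allB n)) (∈-map⁺ (false V.∷_) (allB-complete x))

allB-unique : ∀ n → Unique (allB n)
allB-unique zero    = [] AllPairs.∷ AllPairs.[]
allB-unique (suc n) = Unique.++⁺ (Unique.map⁺ (λ e → proj₂ (V.∷-injective e)) (allB-unique n))
                                 (Unique.map⁺ (λ e → proj₂ (V.∷-injective e)) (allB-unique n)) disjoint
  where
  disjoint : ∀ {v} → v ∈ map (true V.∷_) (allB n) × v ∈ map (false V.∷_) (allB n) → ⊥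
  disjoint (p , q) with ∈-map⁻ (true V.∷_) p | ∈-map⁻ (false V.∷_) q
  ... | _ , _ , refl | _ , _ , ()

length-allB : ∀ n → length (allB n) ≡ 2 ^ n
length-allB zero    = refl
length-allB (suc n) = begin
  length (map (true V.∷_) (allB n) ++ map (false V.∷_) (allB n)) ≡⟨ List.length-++ (map (true V.∷_) (allB n)) ⟩
  length (map (true V.∷_) (allB n)) + length (map (false V.∷_) (allB n))
    ≡⟨ cong₂ _+_ (List.length-map _ (allB n)) (List.length-map _ (allB n)) ⟩
  length (allB n) + length (allB n)                              ≡⟨ cong₂ _+_ (length-allB n) (length-allB n) ⟩
  2 ^ n + 2 ^ n                                                  ≡⟨ cong (2 ^ n +_) (+-identityʳ (2 ^ n)) ⟨
  2 ^ suc n                                                      ∎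
  where open ≡-Reasoning

rankB-injective : ∀ {n} {x y : B n} → rankB x ≡ rankB y → x ≡ y
rankB-injective {x = V.[]}         {V.[]}         e = refl
rankB-injective {x = true V.∷ x}   {true V.∷ y}   e = cong (true V.∷_) (rankB-injective (*-cancelˡ-≡ _ _ 2 (suc-injective e)))
rankB-injective {x = false V.∷ x}  {false V.∷ y}  e = cong (false V.∷_) (rankB-injective (*-cancelˡ-≡ _ _ 2 e))
rankB-injective {x = true V.∷ x}   {false V.∷ y}  e = ⊥-elim (even≢odd (rankB y) (rankB x) (sym e))
rankB-injective {x = false V.∷ x}  {true V.∷ y}   e = ⊥-elim (even≢odd (rankB x) (rankB y) e)

reindex : ∀ {n} → (Fin n → Fin n) → B n → B n
reindex f x = tabulate (λ i → lookup x (f i))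

iter-commute : ∀ {A : Set} (f : A → A) t x → iter f t (f x) ≡ f (iter f t x)
iter-commute f zero    x = refl
iter-commute f (suc t) x = cong f (iter-commute f t x)

iter-reindex : ∀ {n} (f : Fin n → Fin n) t x → iter (reindex f) t x ≡ reindex (iter f t) x
iter-reindex f zero    x = sym (V.tabulate∘lookup x)
iter-reindex f (suc t) x = trans (cong (reindex f) (iter-reindex f t x))
  (V.tabulate-cong (λ i → trans (V.lookup∘tabulate _ (f i)) (cong (lookup x) (iter-commute f t i))))

reindex-inverse : ∀ {n} (f f′ : Fin n → Fin n) → (∀ i → f (f′ i) ≡ i) → ∀ x → reindex f′ (reindex f x) ≡ x
reindex-inverse f f′ f∘f′ x =
  trans (V.tabulate-cong (λ i → trans (V.lookup∘tabulate _ (f′ i)) (cong (lookup x) (f∘f′ i)))) (V.tabulate∘lookup x)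

shift : ∀ {k} → ℕ → Fin k → Fin k
shift {suc k} t i = (toℕ i + t) mod suc k

toℕ-shift : ∀ {k} t (i : Fin (suc k)) → toℕ (shift t i) ≡ (toℕ i + t) % suc k
toℕ-shift {k} t i = Fin.toℕ-fromℕ< (m%n<n (toℕ i + t) (suc k))

shift-shift : ∀ {k} a b (i : Fin k) → shift a (shift b i) ≡ shift (b + a) i
shift-shift {suc k} a b i = Fin.toℕ-injective (begin
  toℕ (shift a (shift b i))           ≡⟨ toℕ-shift a (shift b i) ⟩
  (toℕ (shift b i) + a) % suc k       ≡⟨ cong (λ u → (u + a) % suc k) (toℕ-shift b i) ⟩
  ((toℕ i + b) % suc k + a) % suc k   ≡⟨ %-distribˡ-+ ((toℕ i + b) % suc k) a (suc k) ⟩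
  ((toℕ i + b) % suc k % suc k + a % suc k) % suc k ≡⟨ cong (λ u → (u + a % suc k) % suc k) (m%n%n≡m%n (toℕ i + b) (suc k)) ⟩
  ((toℕ i + b) % suc k + a % suc k) % suc k ≡⟨ %-distribˡ-+ (toℕ i + b) a (suc k) ⟨
  (toℕ i + b + a) % suc k             ≡⟨ cong (_% suc k) (+-assoc (toℕ i) b a) ⟩
  (toℕ i + (b + a)) % suc k           ≡⟨ toℕ-shift (b + a) i ⟨
  toℕ (shift (b + a) i)               ∎)
  where open ≡-Reasoning

shift-0 : ∀ {k} (i : Fin k) → shift 0 i ≡ i
shift-0 {suc k} i = Fin.toℕ-injective
  (trans (toℕ-shift 0 i) (trans (cong (_% suc k) (+-identityʳ (toℕ i))) (m<n⇒m%n≡m (Fin.toℕ<n i))))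

shift-size : ∀ {k} (i : Fin k) → shift k i ≡ i
shift-size {suc k} i = Fin.toℕ-injective
  (trans (toℕ-shift (suc k) i) (trans ([m+n]%n≡m%n (toℕ i) (suc k)) (m<n⇒m%n≡m (Fin.toℕ<n i))))

iter-shift : ∀ {k} t (i : Fin k) → iter (shift 1) t i ≡ shift t i
iter-shift zero    i = sym (shift-0 i)
iter-shift (suc t) i = trans (cong (shift 1) (iter-shift t i)) (trans (shift-shift 1 t i) (cong (λ u → shift u i) (+-comm t 1)))

rotate : ∀ {k} → B k → B k
rotate = reindex (shift 1)

rotate⁻¹ : ∀ {k} → B k → B k
rotate⁻¹ {k} = reindex (shift (k ∸ 1))

rotate⁻¹∘rotate : ∀ k (x : B k) → rotate⁻¹ (rotate x) ≡ x
rotate⁻¹∘rotate zero    = reindex-inverse (shift 1) (shift 0) (λ ())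
rotate⁻¹∘rotate (suc k) = reindex-inverse (shift 1) (shift k)
  (λ i → trans (shift-shift 1 k i) (trans (cong (λ u → shift u i) (+-comm k 1)) (shift-size i)))

iter-rotate : ∀ {k} t (w : B k) → iter rotate t w ≡ reindex (shift t) w
iter-rotate t w = trans (iter-reindex (shift 1) t w) (V.tabulate-cong (λ i → cong (lookup w) (iter-shift t i)))

module Rotation (k : ℕ) = CycleStructure (allB k) allB-complete (allB-unique k) eqB (2 ^ k) (≤-reflexive (length-allB k))
                            rankB rankB-injective rotate rotate⁻¹ (rotate⁻¹∘rotate k)

rotPeriod : ∀ k → B k → ℕ
rotPeriod k = Rotation.period k

cyclic : ∀ {k} → B (suc k) → ℕ → Bool
cyclic {k} w i = lookup w (i mod suc k)

module _ {k : ℕ} where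

  cyclic-cong : ∀ (w : B (suc k)) i j → i % suc k ≡ j % suc k → cyclic w i ≡ cyclic w j
  cyclic-cong w i j e = cong (lookup w) (Fin.toℕ-injective
    (trans (Fin.toℕ-fromℕ< (m%n<n i (suc k))) (trans e (sym (Fin.toℕ-fromℕ< (m%n<n j (suc k)))))))

  cyclic-toℕ : ∀ (w : B (suc k)) j → cyclic w (toℕ j) ≡ lookup w j
  cyclic-toℕ w j = cong (lookup w) (Fin.toℕ-injective
    (trans (Fin.toℕ-fromℕ< (m%n<n (toℕ j) (suc k))) (m<n⇒m%n≡m (Fin.toℕ<n j))))

  toℕ-mod-% : ∀ i → toℕ (i mod suc k) % suc k ≡ i % suc k
  toℕ-mod-% i = trans (cong (_% suc k) (Fin.toℕ-fromℕ< (m%n<n i (suc k)))) (m%n%n≡m%n i (suc k))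

  Periodic : B (suc k) → ℕ → Set
  Periodic w d = ∀ i → cyclic w (i + d) ≡ cyclic w i

  returns⇒periodic : ∀ w t → iter rotate t w ≡ w → Periodic w t
  returns⇒periodic w t e i = begin
    cyclic w (i + t)             ≡⟨ cyclic-cong w (i + t) (toℕ j + t) (trans (%-distribˡ-+ i t (suc k))
                                      (trans (cong (λ u → (u + t % suc k) % suc k) (sym (toℕ-mod-% i)))
                                             (sym (%-distribˡ-+ (toℕ j) t (suc k))))) ⟩
    lookup w (shift t j)         ≡⟨ V.lookup∘tabulate (λ j → lookup w (shift t j)) j ⟨
    lookup (reindex (shift t) w) j ≡⟨ cong (λ v → lookup v j) (trans (sym (iter-rotate t w)) e) ⟩
    lookup w j                   ≡⟨ cyclic-toℕ w j ⟨
    cyclic w (toℕ j)             ≡⟨ cyclic-cong w (toℕ j) i (toℕ-mod-% i) ⟩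
    cyclic w i                   ∎
    where
    open ≡-Reasoning
    j : Fin (suc k)
    j = i mod suc k

  periodic⇒returns : ∀ w t → Periodic w t → iter rotate t w ≡ w
  periodic⇒returns w t p = trans (iter-rotate t w)
    (trans (V.tabulate-cong (λ j → trans (p (toℕ j)) (cyclic-toℕ w j))) (V.tabulate∘lookup w))

  periodic-% : ∀ w d .{{_ : NonZero d}} → Periodic w d → ∀ i → cyclic w i ≡ cyclic w (i % d)
  periodic-% w d p i = trans (cong (cyclic w) (m≡m%n+[m/n]*n i d)) (periodic-+* (i % d) (i / d))
    where
    periodic-+* : ∀ r q → cyclic w (r + q * d) ≡ cyclic w r
    periodic-+* r zero    = cong (cyclic w) (+-identityʳ r)
    periodic-+* r (suc q) = trans (cong (cyclic w) (trans (cong (r +_) (+-comm d (q * d))) (sym (+-assoc r (q * d) d))))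
                                  (trans (p (r + q * d)) (periodic-+* r q))

resize : ∀ {k m} → B (suc k) → B m
resize w = tabulate (λ i → cyclic w (toℕ i))

cyclic-resize : ∀ {d k} (u : B (suc d)) i → cyclic (resize {m = suc k} u) i ≡ cyclic u (i % suc k)
cyclic-resize {k = k} u i = trans (V.lookup∘tabulate (λ j → cyclic u (toℕ j)) (i mod suc k))
                                  (cong (cyclic u) (Fin.toℕ-fromℕ< (m%n<n i (suc k))))

module _ {d k : ℕ} where

  resize-periodic : suc d ∣ suc k → ∀ (u : B (suc d)) → Periodic (resize {m = suc k} u) (suc d)
  resize-periodic d∣k u i = begin
    cyclic (resize u) (i + suc d)      ≡⟨ cyclic-resize u (i + suc d) ⟩
    cyclic u ((i + suc d) % suc k)     ≡⟨ cyclic-cong u ((i + suc d) % suc k) (i % suc k) (begin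
        (i + suc d) % suc k % suc d       ≡⟨ m∣n⇒o%n%m≡o%m (suc d) (suc k) (i + suc d) d∣k ⟩
        (i + suc d) % suc d               ≡⟨ [m+n]%n≡m%n i (suc d) ⟩
        i % suc d                         ≡⟨ m∣n⇒o%n%m≡o%m (suc d) (suc k) i d∣k ⟨
        i % suc k % suc d                 ∎) ⟩
    cyclic u (i % suc k)               ≡⟨ cyclic-resize u i ⟨
    cyclic (resize u) i                ∎
    where open ≡-Reasoning

  periodic⇒resize∘resize : ∀ (w : B (suc k)) → Periodic w (suc d) → w ≡ resize (resize {m = suc d} w)
  periodic⇒resize∘resize w p = trans (sym (V.tabulate∘lookup w)) (V.tabulate-cong (λ i → sym (begin
    cyclic (resize {m = suc d} w) (toℕ i) ≡⟨ cyclic-resize w (toℕ i) ⟩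
    cyclic w (toℕ i % suc d)              ≡⟨ periodic-% w (suc d) p (toℕ i) ⟨
    cyclic w (toℕ i)                      ≡⟨ cyclic-toℕ w i ⟩
    lookup w i                            ∎)))
    where open ≡-Reasoning

  resize-injective : d ≤ k → ∀ {u u′ : B (suc d)} → resize {m = suc k} u ≡ resize u′ → u ≡ u′
  resize-injective d≤k {u} {u′} e = trans (sym (V.tabulate∘lookup u)) (trans (V.tabulate-cong agree) (V.tabulate∘lookup u′))
    where
    agree : ∀ j → lookup u j ≡ lookup u′ j
    agree j = begin
      lookup u j                        ≡⟨ cyclic-toℕ u j ⟨
      cyclic u (toℕ j)                  ≡⟨ cyclic-cong u (toℕ j % suc k) (toℕ j) toℕj%≡ ⟨
      cyclic u (toℕ j % suc k)          ≡⟨ cyclic-resize u (toℕ j) ⟨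
      cyclic (resize u) (toℕ j)         ≡⟨ cong (λ v → cyclic v (toℕ j)) e ⟩
      cyclic (resize u′) (toℕ j)        ≡⟨ cyclic-resize u′ (toℕ j) ⟩
      cyclic u′ (toℕ j % suc k)         ≡⟨ cyclic-cong u′ (toℕ j % suc k) (toℕ j) toℕj%≡ ⟩
      cyclic u′ (toℕ j)                 ≡⟨ cyclic-toℕ u′ j ⟩
      lookup u′ j                       ∎
      where
      open ≡-Reasoning
      toℕj%≡ : toℕ j % suc k % suc d ≡ toℕ j % suc d
      toℕj%≡ = cong (_% suc d) (m<n⇒m%n≡m (<-≤-trans (Fin.toℕ<n j) (s≤s d≤k)))

-- Number of words of each rotation period

count-≡ᵇ-∉ : ∀ v xs → ¬ v ∈ xs → count (v ≡ᵇ_) xs ≡ 0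
count-≡ᵇ-∉ v []       _  = refl
count-≡ᵇ-∉ v (x ∷ xs) v∉ rewrite dec-false (v ≟ x) (λ e → v∉ (here e)) = count-≡ᵇ-∉ v xs (λ v∈ → v∉ (there v∈))

count-≡ᵇ-∈ : ∀ v xs → Unique xs → v ∈ xs → count (v ≡ᵇ_) xs ≡ 1
count-≡ᵇ-∈ v (x ∷ xs) (x∉ AllPairs.∷ _) (here refl) rewrite dec-true (v ≟ v) refl =
  cong suc (count-≡ᵇ-∉ v xs (λ v∈ → All.lookup x∉ v∈ refl))
count-≡ᵇ-∈ v (x ∷ xs) (x∉ AllPairs.∷ u) (there v∈) rewrite dec-false (v ≟ x) (λ e → All.lookup x∉ v∈ (sym e)) =
  count-≡ᵇ-∈ v xs u v∈

positives : ℕ → List ℕ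
positives k = filterᵇ (1 ≤ᵇ_) (upTo k)

divisors-unique : ∀ d → Unique (divisors d)
divisors-unique d = Unique.filter⁺ (_∣? d) (unique-filterᵇ (1 ≤ᵇ_) (Unique.upTo⁺ (suc d)))

∈-divisors⁺ : ∀ {v d} → 1 ≤ v → v ∣ d → v ≤ d → v ∈ divisors d
∈-divisors⁺ {v} {d} 1≤v v∣d v≤d =
  ∈-filter⁺ (_∣? d) (∈-filterᵇ⁺ {p = 1 ≤ᵇ_} (∈-upTo⁺ (s≤s v≤d)) (T⇒≡true (≤⇒≤ᵇ 1≤v))) v∣d

∈-divisors⁻ : ∀ {v d} → v ∈ divisors d → v ∣ d
∈-divisors⁻ {v} {d} v∈ = proj₂ (∈-filter⁻ (_∣? d) {xs = positives (suc d)} v∈)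

∈-properDivisors⁻ : ∀ {v d} → v ∈ properDivisors d → v ∣ d × v < d
∈-properDivisors⁻ {v} {d} v∈ with ∈-filter⁻ (_∣? d) {xs = positives d} v∈
... | v∈positives , v∣d = v∣d , ∈-upTo⁻ (proj₁ (∈-filterᵇ⁻ (1 ≤ᵇ_) (upTo d) v∈positives))

divisors≡properDivisors∷ʳ : ∀ d .{{_ : NonZero d}} → divisors d ≡ properDivisors d ++ [ d ]
divisors≡properDivisors∷ʳ d = begin
  filter (_∣? d) (filterᵇ (1 ≤ᵇ_) (upTo (suc d)))      ≡⟨ cong (λ l → filter (_∣? d) (filterᵇ (1 ≤ᵇ_) l)) (sym (List.upTo-∷ʳ d)) ⟩
  filter (_∣? d) (filterᵇ (1 ≤ᵇ_) (upTo d ++ [ d ]))   ≡⟨ cong (filter (_∣? d)) (List.filter-++ (T? ∘ (1 ≤ᵇ_)) (upTo d) [ d ]) ⟩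
  filter (_∣? d) (positives d ++ filterᵇ (1 ≤ᵇ_) [ d ]) ≡⟨ cong (λ l → filter (_∣? d) (positives d ++ l))
                                                             (List.filter-accept (T? ∘ (1 ≤ᵇ_)) (≤⇒≤ᵇ (>-nonZero⁻¹ d))) ⟩
  filter (_∣? d) (positives d ++ [ d ])                ≡⟨ List.filter-++ (_∣? d) (positives d) [ d ] ⟩
  properDivisors d ++ filter (_∣? d) [ d ]              ≡⟨ cong (properDivisors d ++_) (List.filter-accept (_∣? d) ∣-refl) ⟩
  properDivisors d ++ [ d ]                            ∎
  where open ≡-Reasoning

χ-∣≡count : ∀ v d → 1 ≤ v → .{{_ : NonZero d}} → χ (does (v ∣? d)) ≡ count (v ≡ᵇ_) (divisors d)
χ-∣≡count v d 1≤v with v ∣? d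
... | yes v∣d = sym (count-≡ᵇ-∈ v _ (divisors-unique d) (∈-divisors⁺ 1≤v v∣d (∣⇒≤ v∣d)))
... | no  v∤d = sym (count-≡ᵇ-∉ v _ (λ v∈ → v∤d (∈-divisors⁻ v∈)))

#period : ℕ → ℕ → ℕ
#period k z = count (λ w → rotPeriod k w ≡ᵇ z) (allB k)

rotPeriod∣length : ∀ k (w : B k) → rotPeriod k w ∣ k
rotPeriod∣length k w = Rotation.returns⇒period∣ k w k
  (trans (iter-rotate k w) (trans (V.tabulate-cong (λ i → cong (lookup w) (shift-size i))) (V.tabulate∘lookup w)))

∣-#period : ∀ k z → z ∣ #period k z
∣-#period k z = divides (numCycles (allB k) eqB (2 ^ k) rankB rotate z) (sym (Rotation.numCycles*j k z))

-- For d ∣ k the words of length k whose period divides d are the circular readings of the words of length d.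
count-rotPeriod∣ : ∀ {d k} → suc d ∣ suc k → count (λ w → does (rotPeriod (suc k) w ∣? suc d)) (allB (suc k)) ≡ 2 ^ suc d
count-rotPeriod∣ {d} {k} d∣k = begin
  count P (allB (suc k))                   ≡⟨ length-filterᵇ P (allB (suc k)) ⟨
  length (filterᵇ P (allB (suc k)))        ≡⟨ unique-sameMembers⇒length≡ (unique-filterᵇ P (allB-unique (suc k)))
                                                (Unique.map⁺ (resize-injective (≤-pred (∣⇒≤ d∣k))) (allB-unique (suc d)))
                                                periodic⇒resized resized⇒periodic ⟩
  length (map resize (allB (suc d)))       ≡⟨ List.length-map resize (allB (suc d)) ⟩
  length (allB (suc d))                    ≡⟨ length-allB (suc d) ⟩
  2 ^ suc d                                ∎
  where
  open ≡-Reasoning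
  module R = Rotation (suc k)
  P : B (suc k) → Bool
  P w = does (rotPeriod (suc k) w ∣? suc d)
  periodic⇒resized : ∀ {w} → w ∈ filterᵇ P (allB (suc k)) → w ∈ map resize (allB (suc d))
  periodic⇒resized {w} w∈ = subst (_∈ map resize (allB (suc d)))
    (sym (periodic⇒resize∘resize w (returns⇒periodic w (suc d)
      (R.period∣⇒returns w (suc d) (dec-true⁻¹ (_ ∣? suc d) (proj₂ (∈-filterᵇ⁻ P (allB (suc k)) w∈)))))))
    (∈-map⁺ resize (allB-complete (resize w)))
  resized⇒periodic : ∀ {w} → w ∈ map resize (allB (suc d)) → w ∈ filterᵇ P (allB (suc k))
  resized⇒periodic w∈ with ∈-map⁻ resize w∈
  ... | u , _ , refl = ∈-filterᵇ⁺ (allB-complete (resize u))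
    (dec-true (_ ∣? suc d) (R.returns⇒period∣ (resize u) (suc d)
      (periodic⇒returns (resize u) (suc d) (resize-periodic d∣k u))))

∑-#period-divisors : ∀ {d k} → suc d ∣ suc k → ∑ (divisors (suc d)) (#period (suc k)) ≡ 2 ^ suc d
∑-#period-divisors {d} {k} d∣k = begin
  ∑ (divisors (suc d)) (#period (suc k))
    ≡⟨ ∑-swap (allB (suc k)) (divisors (suc d)) (λ w z → χ (rotPeriod (suc k) w ≡ᵇ z)) ⟨
  ∑ (allB (suc k)) (λ w → count (rotPeriod (suc k) w ≡ᵇ_) (divisors (suc d)))
    ≡⟨ ∑-cong (allB (suc k)) (λ w _ → χ-∣≡count (rotPeriod (suc k) w) (suc d) (Rotation.period-pos (suc k) w)) ⟨
  count (λ w → does (rotPeriod (suc k) w ∣? suc d)) (allB (suc k))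
    ≡⟨ count-rotPeriod∣ d∣k ⟩
  2 ^ suc d ∎
  where open ≡-Reasoning

-- Only the values eAux f d for d ≤ f are meaningful, and those do not depend on the fuel f.
eAux-fuel : ∀ f f′ d → d ≤ f → d ≤ f′ → eAux f d ≡ eAux f′ d
eAux-fuel zero    zero     zero          _ _  = refl
eAux-fuel zero    (suc f′) zero          _ _  = refl
eAux-fuel (suc f) zero     zero          _ _  = refl
eAux-fuel (suc f) (suc f′) zero          _ _  = refl
eAux-fuel (suc f) (suc f′) (suc zero)    _ _  = refl
eAux-fuel (suc f) (suc f′) (suc (suc d)) h h′ =
  cong (λ s → (2 ^ suc (suc d) ∸ s) / suc (suc d)) (∑-cong (properDivisors (suc (suc d))) (λ x x∈ →
    let x<d+2 = proj₂ (∈-properDivisors⁻ x∈) in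
    cong (x *_) (eAux-fuel f f′ x (≤-pred (≤-trans x<d+2 h)) (≤-pred (≤-trans x<d+2 h′)))))

e-rec : ∀ z .{{_ : NonZero z}} → e z ≡ (2 ^ z ∸ ∑ (properDivisors z) (λ d → d * e d)) / z
e-rec (suc zero)    = refl
e-rec (suc (suc z)) = cong (λ s → (2 ^ suc (suc z) ∸ s) / suc (suc z)) (∑-cong (properDivisors (suc (suc z))) (λ d d∈ →
  cong (d *_) (eAux-fuel (suc z) d d (≤-pred (proj₂ (∈-properDivisors⁻ d∈))) ≤-refl)))

-- Strong induction on z: the divisors z′ ∣ z partition the words of period dividing z.
#period≡*e : ∀ k z → z ∣ suc k → #period (suc k) z ≡ z * e z
#period≡*e k = <-rec (λ z → z ∣ suc k → #period (suc k) z ≡ z * e z) step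
  where
  step : ∀ z → (∀ {y} → y < z → y ∣ suc k → #period (suc k) y ≡ y * e y) → z ∣ suc k → #period (suc k) z ≡ z * e z
  step zero          _  0∣k with () ← 0∣⇒≡0 0∣k
  step z@(suc z-1) rec z∣k = begin
    #period (suc k) z                 ≡⟨ m*[n/m]≡n (∣-#period (suc k) z) ⟨
    z * (#period (suc k) z / z)       ≡⟨ cong (λ u → z * (u / z)) #period≡2^z∸S ⟩
    z * ((2 ^ z ∸ S) / z)             ≡⟨ cong (z *_) (e-rec z) ⟨
    z * e z                           ∎
    where
    open ≡-Reasoning
    S : ℕ
    S = ∑ (properDivisors z) (λ d → d * e d)
    ∑-proper≡S : ∑ (properDivisors z) (#period (suc k)) ≡ S
    ∑-proper≡S = ∑-cong (properDivisors z) (λ d d∈ →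
      let d∣z , d<z = ∈-properDivisors⁻ d∈ in rec d<z (∣-trans d∣z z∣k))
    S+#period≡2^z : S + #period (suc k) z ≡ 2 ^ z
    S+#period≡2^z = begin
      S + #period (suc k) z                             ≡⟨ cong₂ _+_ ∑-proper≡S (+-identityʳ _) ⟨
      ∑ (properDivisors z) P + ∑ [ z ] P                ≡⟨ ∑-++ (properDivisors z) [ z ] P ⟨
      ∑ (properDivisors z ++ [ z ]) P                   ≡⟨ cong (λ l → ∑ l P) (divisors≡properDivisors∷ʳ z) ⟨
      ∑ (divisors z) P                                  ≡⟨ ∑-#period-divisors z∣k ⟩
      2 ^ z                                             ∎
      where
      P : ℕ → ℕ
      P = #period (suc k)
    #period≡2^z∸S : #period (suc k) z ≡ 2 ^ z ∸ S
    #period≡2^z∸S = trans (sym (m+n∸m≡n S _)) (cong (_∸ S) S+#period≡2^z)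

Words : List ℕ → Set
Words []       = ⊤
Words (k ∷ ks) = B k × Words ks

allWords : ∀ ks → List (Words ks)
allWords []       = [ tt ]
allWords (k ∷ ks) = concatMap (λ w → map (w ,_) (allWords ks)) (allB k)

_≟Words_ : ∀ {ks} → DecidableEquality (Words ks)
_≟Words_ {[]}     tt tt = yes refl
_≟Words_ {k ∷ ks} = ×.≡-dec eqB _≟Words_

allWords-complete : ∀ ks (ws : Words ks) → ws ∈ allWords ks
allWords-complete []       tt       = here refl
allWords-complete (k ∷ ks) (w , ws) = ∈-concatMap⁺ (λ w → map (w ,_) (allWords ks))
  (Any.map (λ { refl → ∈-map⁺ (w ,_) (allWords-complete ks ws) }) (allB-complete w))

allWords-unique : ∀ ks → Unique (allWords ks)
allWords-unique []       = [] AllPairs.∷ AllPairs.[]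
allWords-unique (k ∷ ks) =
  Unique.concat⁺ (AllP.map⁺ (All.tabulate (λ _ → Unique.map⁺ (cong proj₂) (allWords-unique ks))))
                 (AllPairsP.map⁺ (AllPairs.map disjoint (allB-unique k)))
  where
  disjoint : ∀ {w w′ : B k} → w ≢ w′ → Disjoint (map (w ,_) (allWords ks)) (map (w′ ,_) (allWords ks))
  disjoint w≢w′ (p , q) with ∈-map⁻ _ p | ∈-map⁻ _ q
  ... | _ , _ , refl | _ , _ , e = w≢w′ (cong proj₁ e)

length-allWords : ∀ ks → length (allWords ks) ≡ 2 ^ sum ks
length-allWords []       = refl
length-allWords (k ∷ ks) = begin
  length (concatMap (λ w → map (w ,_) (allWords ks)) (allB k)) ≡⟨ length-concatMap (λ w → map (w ,_) (allWords ks)) (allB k) ⟩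
  ∑ (allB k) (λ w → length (map (w ,_) (allWords ks)))         ≡⟨ ∑-cong (allB k) (λ w _ → trans (List.length-map (w ,_) (allWords ks)) (length-allWords ks)) ⟩
  ∑ (allB k) (λ _ → 2 ^ sum ks)                                ≡⟨ ∑-const (allB k) (2 ^ sum ks) ⟩
  length (allB k) * 2 ^ sum ks                                 ≡⟨ cong (_* 2 ^ sum ks) (length-allB k) ⟩
  2 ^ k * 2 ^ sum ks                                           ≡⟨ ^-distribˡ-+-* 2 k (sum ks) ⟨
  2 ^ (k + sum ks)                                             ∎
  where open ≡-Reasoning

rotPeriods : ∀ ks → Words ks → List ℕ
rotPeriods []       _        = []
rotPeriods (k ∷ ks) (w , ws) = rotPeriod k w ∷ rotPeriods ks ws

weight : List ℕ → ℕ
weight zs = product (map (λ z → z * e z) zs)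

∑-by-rotPeriod : ∀ k (G : ℕ → ℕ) →
                 ∑ (allB (suc k)) (λ w → G (rotPeriod (suc k) w)) ≡ ∑ (divisors (suc k)) (λ z → #period (suc k) z * G z)
∑-by-rotPeriod k G = begin
  ∑ (allB (suc k)) (λ w → G (rotPeriod (suc k) w))
    ≡⟨ ∑-cong (allB (suc k)) (λ w _ → sym (pick w)) ⟩
  ∑ (allB (suc k)) (λ w → ∑ (divisors (suc k)) (λ z → χ (rotPeriod (suc k) w ≡ᵇ z) * G z))
    ≡⟨ ∑-swap (allB (suc k)) (divisors (suc k)) (λ w z → χ (rotPeriod (suc k) w ≡ᵇ z) * G z) ⟩
  ∑ (divisors (suc k)) (λ z → ∑ (allB (suc k)) (λ w → χ (rotPeriod (suc k) w ≡ᵇ z) * G z))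
    ≡⟨ ∑-cong (divisors (suc k)) (λ z _ → ∑-χ*-const (allB (suc k)) (λ w → rotPeriod (suc k) w ≡ᵇ z) (λ _ → G z) (G z) (λ _ _ → refl)) ⟩
  ∑ (divisors (suc k)) (λ z → #period (suc k) z * G z) ∎
  where
  open ≡-Reasoning
  pick : ∀ w → ∑ (divisors (suc k)) (λ z → χ (rotPeriod (suc k) w ≡ᵇ z) * G z) ≡ G (rotPeriod (suc k) w)
  pick w = let p = rotPeriod (suc k) w in begin
    ∑ (divisors (suc k)) (λ z → χ (p ≡ᵇ z) * G z) ≡⟨ ∑-χ*-const (divisors (suc k)) (p ≡ᵇ_) G (G p)
                                                       (λ z p≡ᵇz → cong G (sym (≡ᵇ⇒≡ p z (≡true⇒T p≡ᵇz)))) ⟩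
    count (p ≡ᵇ_) (divisors (suc k)) * G p        ≡⟨ cong (_* G p) (count-≡ᵇ-∈ p (divisors (suc k)) (divisors-unique (suc k))
                                                       (∈-divisors⁺ (Rotation.period-pos (suc k) w) (rotPeriod∣length (suc k) w)
                                                                    (∣⇒≤ (rotPeriod∣length (suc k) w)))) ⟩
    1 * G p                                       ≡⟨ *-identityˡ (G p) ⟩
    G p                                           ∎

-- Sorting the tuples of words by their tuple of periods (z₁,…,z_m); by #period≡*e each tuple occurs weight times.
∑-by-rotPeriods : ∀ ks → All NonZero ks → ∀ (H : List ℕ → ℕ) →
                  ∑ (allWords ks) (λ ws → H (rotPeriods ks ws)) ≡ ∑ (divTuples ks) (λ zs → H zs * weight zs)
∑-by-rotPeriods []           []           H = trans (+-identityʳ (H [])) (sym (trans (+-identityʳ (H [] * 1)) (*-identityʳ (H []))))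
∑-by-rotPeriods (suc k ∷ ks) (_ ∷ ks≢0)   H = begin
  ∑ (concatMap (λ w → map (w ,_) (allWords ks)) (allB (suc k))) (λ ws → H (rotPeriods (suc k ∷ ks) ws))
    ≡⟨ ∑-concatMap (allB (suc k)) (λ w → map (w ,_) (allWords ks)) _ ⟩
  ∑ (allB (suc k)) (λ w → ∑ (map (w ,_) (allWords ks)) (λ ws → H (rotPeriods (suc k ∷ ks) ws)))
    ≡⟨ ∑-cong (allB (suc k)) (λ w _ → trans (∑-map (allWords ks) (w ,_) _) (∑-by-rotPeriods ks ks≢0 (λ zs → H (rotPeriod (suc k) w ∷ zs)))) ⟩
  ∑ (allB (suc k)) (λ w → ∑ (divTuples ks) (λ zs → H (rotPeriod (suc k) w ∷ zs) * weight zs))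
    ≡⟨ ∑-swap (allB (suc k)) (divTuples ks) (λ w zs → H (rotPeriod (suc k) w ∷ zs) * weight zs) ⟩
  ∑ (divTuples ks) (λ zs → ∑ (allB (suc k)) (λ w → H (rotPeriod (suc k) w ∷ zs) * weight zs))
    ≡⟨ ∑-cong (divTuples ks) (λ zs _ → ∑-by-rotPeriod k (λ z → H (z ∷ zs) * weight zs)) ⟩
  ∑ (divTuples ks) (λ zs → ∑ (divisors (suc k)) (λ z → #period (suc k) z * (H (z ∷ zs) * weight zs)))
    ≡⟨ ∑-swap (divTuples ks) (divisors (suc k)) (λ zs z → #period (suc k) z * (H (z ∷ zs) * weight zs)) ⟩
  ∑ (divisors (suc k)) (λ z → ∑ (divTuples ks) (λ zs → #period (suc k) z * (H (z ∷ zs) * weight zs)))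
    ≡⟨ ∑-cong (divisors (suc k)) (λ z z∈ → ∑-cong (divTuples ks) (λ zs _ → regroup z zs (#period≡*e k z (∈-divisors⁻ z∈)))) ⟩
  ∑ (divisors (suc k)) (λ z → ∑ (divTuples ks) (λ zs → H (z ∷ zs) * weight (z ∷ zs)))
    ≡⟨ ∑-cong (divisors (suc k)) (λ z _ → ∑-map (divTuples ks) (z ∷_) (λ zs → H zs * weight zs)) ⟨
  ∑ (divisors (suc k)) (λ z → ∑ (map (z ∷_) (divTuples ks)) (λ zs → H zs * weight zs))
    ≡⟨ ∑-concatMap (divisors (suc k)) (λ z → map (z ∷_) (divTuples ks)) (λ zs → H zs * weight zs) ⟨
  ∑ (concatMap (λ z → map (z ∷_) (divTuples ks)) (divisors (suc k))) (λ zs → H zs * weight zs) ∎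
  where
  open ≡-Reasoning
  regroup : ∀ z zs → #period (suc k) z ≡ z * e z → #period (suc k) z * (H (z ∷ zs) * weight zs) ≡ H (z ∷ zs) * weight (z ∷ zs)
  regroup z zs #≡ rewrite #≡ = m*[n*o]≡n*[m*o] (z * e z) (H (z ∷ zs)) (weight zs)

lcmList-least : ∀ {t} zs → All (_∣ t) zs → lcmList zs ∣ t
lcmList-least []       []         = 1∣ _
lcmList-least (z ∷ zs) (z∣t ∷ zs∣t) = lcm-least z∣t (lcmList-least zs zs∣t)

lcmList∣⇒All∣ : ∀ {t} zs → lcmList zs ∣ t → All (_∣ t) zs
lcmList∣⇒All∣ []       _ = []
lcmList∣⇒All∣ (z ∷ zs) l∣t =
  ∣-trans (m∣lcm[m,n] z (lcmList zs)) l∣t ∷ lcmList∣⇒All∣ zs (∣-trans (n∣lcm[m,n] z (lcmList zs)) l∣t)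

lcmList∣product : ∀ zs → lcmList zs ∣ product zs
lcmList∣product []       = ∣-refl
lcmList∣product (z ∷ zs) = lcm-least (m∣m*n {z} (product zs)) (∣n⇒∣m*n z (lcmList∣product zs))

product∣weight : ∀ zs → product zs ∣ weight zs
product∣weight []       = ∣-refl
product∣weight (z ∷ zs) = ∣-trans (*-monoʳ-∣ z (product∣weight zs)) (*-monoˡ-∣ (weight zs) (m∣m*n {z} (e z)))

-- The division in formula is exact, as j = lcm zs divides weight zs.
formula*j : ∀ ks j .{{_ : NonZero j}} → formula ks j * j ≡ ∑ (divTuples ks) (λ zs → χ (lcmList zs ≡ᵇ j) * weight zs)
formula*j ks j = begin
  formula ks j * j                                          ≡⟨ ∑-*ʳ (filterᵇ p (divTuples ks)) (λ zs → weight zs / j) j ⟩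
  ∑ (filterᵇ p (divTuples ks)) (λ zs → weight zs / j * j)    ≡⟨ ∑-filterᵇ p (divTuples ks) (λ zs → weight zs / j * j) ⟩
  ∑ (divTuples ks) (λ zs → χ (p zs) * (weight zs / j * j))   ≡⟨ ∑-cong (divTuples ks) (λ zs _ → exact zs) ⟩
  ∑ (divTuples ks) (λ zs → χ (p zs) * weight zs)             ∎
  where
  open ≡-Reasoning
  p : List ℕ → Bool
  p zs = lcmList zs ≡ᵇ j
  exact : ∀ zs → χ (p zs) * (weight zs / j * j) ≡ χ (p zs) * weight zs
  exact zs with lcmList zs ≡ᵇ j in lcm≡ᵇj
  ... | false = refl
  ... | true  = cong (_+ 0) (m/n*n≡m (subst (_∣ weight zs) (≡ᵇ⇒≡ _ j (≡true⇒T lcm≡ᵇj))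
                                         (∣-trans (lcmList∣product zs) (product∣weight zs))))

-- Splitting a word along the cycles of σ

module Split (n : ℕ) (σ : Permutation′ n) where

  module S = CycleStructure (allFin n) ∈-allFin (Unique.allFin⁺ n) Fin._≟_ n (≤-reflexive (List.length-tabulate {n = n} id))
                            toℕ Fin.toℕ-injective (σ ⟨$⟩ʳ_) (σ ⟨$⟩ˡ_) (λ _ → inverseˡ σ)

  module S′ = CycleStructure (allB n) allB-complete (allB-unique n) eqB (2 ^ n) (≤-reflexive (length-allB n))
                             rankB rankB-injective (lift σ) (reindex (σ ⟨$⟩ˡ_))
                             (reindex-inverse (σ ⟨$⟩ʳ_) (σ ⟨$⟩ˡ_) (λ _ → inverseʳ σ))

  ks : List ℕ
  ks = map S.period S.leaders

  word : ∀ c → B n → B (S.period c)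
  word c x = tabulate (λ r → lookup x (S.g^ (toℕ r) c))

  split′ : ∀ cs → B n → Words (map S.period cs)
  split′ []       x = tt
  split′ (c ∷ cs) x = word c x , split′ cs x

  split : B n → Words ks
  split = split′ S.leaders

  lookup-word : ∀ c x (ρ : Fin (S.period c)) → lookup (word c x) ρ ≡ lookup x (S.g^ (toℕ ρ) c)
  lookup-word c x ρ = V.lookup∘tabulate (λ r → lookup x (S.g^ (toℕ r) c)) ρ

  lookup-rotate-word : ∀ c t x (ρ : Fin (S.period c)) →
                       lookup (iter rotate t (word c x)) ρ ≡ lookup x (S.g^ t (S.g^ (toℕ ρ) c))
  lookup-rotate-word c t x ρ = begin
    lookup (iter rotate t (word c x)) ρ           ≡⟨ cong (λ v → lookup v ρ) (iter-rotate t (word c x)) ⟩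
    lookup (reindex (shift t) (word c x)) ρ       ≡⟨ V.lookup∘tabulate (λ r → lookup (word c x) (shift t r)) ρ ⟩
    lookup (word c x) (shift t ρ)                 ≡⟨ lookup-word c x (shift t ρ) ⟩
    lookup x (S.g^ (toℕ (shift t ρ)) c)           ≡⟨ cong (λ u → lookup x (S.g^ u c)) (toℕ-shift′ t ρ) ⟩
    lookup x (S.g^ ((toℕ ρ + t) % S.period c) c)  ≡⟨ cong (lookup x) (S.g^-%period c (toℕ ρ + t)) ⟨
    lookup x (S.g^ (toℕ ρ + t) c)                 ≡⟨ cong (lookup x) (trans (S.g^-+ (toℕ ρ) t c) (S.g^-comm (toℕ ρ) t c)) ⟩
    lookup x (S.g^ t (S.g^ (toℕ ρ) c))            ∎
    where
    open ≡-Reasoning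
    toℕ-shift′ : ∀ {p} .{{_ : NonZero p}} t (ρ : Fin p) → toℕ (shift t ρ) ≡ (toℕ ρ + t) % p
    toℕ-shift′ {suc p} = toℕ-shift

  lift-returns⇔ : ∀ t x → (iter (lift σ) t x ≡ x) ⇔ (∀ i → lookup x (S.g^ t i) ≡ lookup x i)
  lift-returns⇔ t x = mk⇔
    (λ e i → trans (sym (V.lookup∘tabulate (λ i → lookup x (S.g^ t i)) i))
                   (cong (λ v → lookup v i) (trans (sym (iter-reindex (σ ⟨$⟩ʳ_) t x)) e)))
    (λ h → trans (iter-reindex (σ ⟨$⟩ʳ_) t x) (trans (V.tabulate-cong h) (V.tabulate∘lookup x)))

  word-returns⇔ : ∀ t x → (∀ i → lookup x (S.g^ t i) ≡ lookup x i) ⇔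
                          (∀ {c} → c ∈ S.leaders → iter rotate t (word c x) ≡ word c x)
  word-returns⇔ t x = mk⇔
    (λ h {c} _ → trans (sym (V.tabulate∘lookup _)) (trans (V.tabulate-cong (λ ρ →
      trans (lookup-rotate-word c t x ρ) (trans (h (S.g^ (toℕ ρ) c)) (sym (lookup-word c x ρ))))) (V.tabulate∘lookup _)))
    (λ h i → on-cycle h (S.leader-covers i))
    where
    on-cycle : ∀ {i} → (∀ {c} → c ∈ S.leaders → iter rotate t (word c x) ≡ word c x) →
               (∃ λ c → c ∈ S.leaders × ∃ λ r → r < S.period c × S.g^ r c ≡ i) → lookup x (S.g^ t i) ≡ lookup x i
    on-cycle h (c , c∈ , r , r< , refl) = begin
      lookup x (S.g^ t (S.g^ r c))           ≡⟨ cong (λ u → lookup x (S.g^ t (S.g^ u c))) (Fin.toℕ-fromℕ< r<) ⟨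
      lookup x (S.g^ t (S.g^ (toℕ ρ) c))     ≡⟨ lookup-rotate-word c t x ρ ⟨
      lookup (iter rotate t (word c x)) ρ    ≡⟨ cong (λ v → lookup v ρ) (h c∈) ⟩
      lookup (word c x) ρ                    ≡⟨ lookup-word c x ρ ⟩
      lookup x (S.g^ (toℕ ρ) c)              ≡⟨ cong (λ u → lookup x (S.g^ u c)) (Fin.toℕ-fromℕ< r<) ⟩
      lookup x (S.g^ r c)                    ∎
      where
      open ≡-Reasoning
      ρ : Fin (S.period c)
      ρ = fromℕ< r<

  rotPeriods-split′ : ∀ cs x → rotPeriods (map S.period cs) (split′ cs x) ≡ map (λ c → rotPeriod (S.period c) (word c x)) cs
  rotPeriods-split′ []       x = refl
  rotPeriods-split′ (c ∷ cs) x = cong (rotPeriod (S.period c) (word c x) ∷_) (rotPeriods-split′ cs x)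

  -- σ′ᵗ fixes x iff every cycle word of x is fixed by rotation by t.
  period≡lcm : ∀ x → S′.period x ≡ lcmList (rotPeriods ks (split x))
  period≡lcm x = trans (S′.period-unique x (lcmList ps) returns⇒lcm∣ lcm∣⇒returns)
                       (cong lcmList (sym (rotPeriods-split′ S.leaders x)))
    where
    ps : List ℕ
    ps = map (λ c → rotPeriod (S.period c) (word c x)) S.leaders
    returns⇒lcm∣ : ∀ t → iter (lift σ) t x ≡ x → lcmList ps ∣ t
    returns⇒lcm∣ t e = lcmList-least ps (AllP.map⁺ (All.tabulate (λ {c} c∈ →
      Rotation.returns⇒period∣ (S.period c) (word c x) t
        (Equivalence.to (word-returns⇔ t x) (Equivalence.to (lift-returns⇔ t x) e) c∈))))
    lcm∣⇒returns : ∀ t → lcmList ps ∣ t → iter (lift σ) t x ≡ x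
    lcm∣⇒returns t l∣t = Equivalence.from (lift-returns⇔ t x) (Equivalence.from (word-returns⇔ t x) (λ {c} c∈ →
      Rotation.period∣⇒returns (S.period c) (word c x) t (All.lookup (AllP.map⁻ (lcmList∣⇒All∣ ps l∣t)) c∈)))

  split′-word : ∀ cs {x y} → split′ cs x ≡ split′ cs y → ∀ {c} → c ∈ cs → word c x ≡ word c y
  split′-word (c ∷ cs) e (here refl) = cong proj₁ e
  split′-word (c ∷ cs) e (there c∈)  = split′-word cs (cong proj₂ e) c∈

  split-injective : ∀ {x y} → split x ≡ split y → x ≡ y
  split-injective {x} {y} e =
    trans (sym (V.tabulate∘lookup x)) (trans (V.tabulate-cong (λ i → on-cycle (S.leader-covers i))) (V.tabulate∘lookup y))
    where
    on-cycle : ∀ {i} → (∃ λ c → c ∈ S.leaders × ∃ λ r → r < S.period c × S.g^ r c ≡ i) → lookup x i ≡ lookup y i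
    on-cycle (c , c∈ , r , r< , refl) = begin
      lookup x (S.g^ r c)                ≡⟨ cong (λ u → lookup x (S.g^ u c)) (Fin.toℕ-fromℕ< r<) ⟨
      lookup x (S.g^ (toℕ (fromℕ< r<)) c) ≡⟨ lookup-word c x (fromℕ< r<) ⟨
      lookup (word c x) (fromℕ< r<)      ≡⟨ cong (λ v → lookup v (fromℕ< r<)) (split′-word S.leaders e c∈) ⟩
      lookup (word c y) (fromℕ< r<)      ≡⟨ lookup-word c y (fromℕ< r<) ⟩
      lookup y (S.g^ (toℕ (fromℕ< r<)) c) ≡⟨ cong (λ u → lookup y (S.g^ u c)) (Fin.toℕ-fromℕ< r<) ⟩
      lookup y (S.g^ r c)                ∎
      where open ≡-Reasoning

  -- split is a bijection: it is injective and both sides have 2ⁿ elements, the cycle lengths summing to n.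
  split-↭ : map split (allB n) ↭ allWords ks
  split-↭ = unique-sameMembers⇒↭ unique-image (allWords-unique ks) (λ _ → allWords-complete ks _)
              (unique-⊆-length≥⇒⊇ _≟Words_ unique-image (λ _ → allWords-complete ks _) (≤-reflexive same-length))
    where
    unique-image : Unique (map split (allB n))
    unique-image = Unique.map⁺ split-injective (allB-unique n)
    same-length : length (allWords ks) ≡ length (map split (allB n))
    same-length = begin
      length (allWords ks)       ≡⟨ length-allWords ks ⟩
      2 ^ sum ks                 ≡⟨ cong (2 ^_) (trans S.∑-periods (List.length-tabulate {n = n} id)) ⟩
      2 ^ n                      ≡⟨ length-allB n ⟨
      length (allB n)            ≡⟨ List.length-map split (allB n) ⟨
      length (map split (allB n)) ∎
      where open ≡-Reasoning

  ks-nonZero : All NonZero ks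
  ks-nonZero = AllP.map⁺ (All.tabulate (λ {c} _ → S.period-nonZero {c}))

  p′*j : ∀ j .{{_ : NonZero j}} → p′ σ j * j ≡ formula (cycleType σ) j * j
  p′*j j = begin
    p′ σ j * j
      ≡⟨ S′.numCycles*j j ⟩
    ∑ (allB n) (λ x → χ (S′.period x ≡ᵇ j))
      ≡⟨ ∑-cong (allB n) (λ x _ → cong (λ u → χ (u ≡ᵇ j)) (period≡lcm x)) ⟩
    ∑ (allB n) (λ x → [lcm≡j] (rotPeriods ks (split x)))
      ≡⟨ ∑-map (allB n) split (λ ws → [lcm≡j] (rotPeriods ks ws)) ⟨
    ∑ (map split (allB n)) (λ ws → [lcm≡j] (rotPeriods ks ws))
      ≡⟨ ∑-↭ (λ ws → [lcm≡j] (rotPeriods ks ws)) split-↭ ⟩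
    ∑ (allWords ks) (λ ws → [lcm≡j] (rotPeriods ks ws))
      ≡⟨ ∑-by-rotPeriods ks ks-nonZero [lcm≡j] ⟩
    ∑ (divTuples ks) (λ zs → [lcm≡j] zs * weight zs)
      ≡⟨ formula*j ks j ⟨
    formula (cycleType σ) j * j ∎
    where
    open ≡-Reasoning
    [lcm≡j] : List ℕ → ℕ
    [lcm≡j] zs = χ (lcmList zs ≡ᵇ j)

theorem2 : (n : ℕ) → 1 ≤ n → (σ : Permutation′ n) →
    (j : ℕ) → .{{_ : NonZero j}} → p′ σ j ≡ formula (cycleType σ) j
theorem2 n _ σ j = *-cancelʳ-≡ (p′ σ j) (formula (cycleType σ) j) j (Split.p′*j n σ j)
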